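{- For every nonnegative integer $n$, $$\sum_{i=1}^{n}\binom{4i}{2i-1}\binom{4n-4i}{2n-2i}=\sum_{i=0}^{n-1}\binom{4i+2}{2i+1}\binom{4n-4i-2}{2n-2i-1}.$$
   Context: Empty sums are zero. -}

module Defs where

open import Data.Nat using (ℕ; zero; suc; _+_)

sumRange : ℕ → (ℕ → ℕ) → ℕ
sumRange zero    f = 0
sumRange (suc n) f = sumRange n f + f n

-- Write c k for the central binomial coefficient (2k choose k). Pascal's rule gives
-- c (2j+1) = 2 c (2j) + 2 (4j choose 2j-1), so the odd-even convolution
-- Σ c (2i+1) c (2(n-i)) is twice the even-even convolution plus twice the left-hand side.
-- The recurrence (k+1) c (k+1) = 2 (2k+1) c k, together with the pairing i ↔ m - i, yields
-- the classical Σ_{i ≤ m} c i c (m-i) = 4^m. Splitting this sum by the parity of i at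
-- m = 2n+1 and m = 2n shows that the same odd-even convolution is also twice the
-- even-even convolution plus twice the right-hand side.
module Submission where

open import Defs
open import Data.Nat using (ℕ; zero; suc; _+_; _*_; _∸_; _^_; _≤_; _<_)
open import Data.Nat.Properties
open import Data.Nat.Combinatorics using (_C_; nCk+nC[k+1]≡[n+1]C[k+1]; nCk≡nC[n∸k]; nC1≡n)
open import Data.Nat.Tactic.RingSolver using (solve-∀)
open import Relation.Binary.PropositionalEquality
open ≡-Reasoning

sumRange-cong : ∀ n {f g : ℕ → ℕ} →
  (∀ i → i < n → f i ≡ g i) → sumRange n f ≡ sumRange n g
sumRange-cong zero    f≗g = refl
sumRange-cong (suc n) f≗g =
  cong₂ _+_ (sumRange-cong n (λ i i<n → f≗g i (m<n⇒m<1+n i<n))) (f≗g n (n<1+n n))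

sumRange-+ : ∀ n (f g : ℕ → ℕ) → sumRange n (λ i → f i + g i) ≡ sumRange n f + sumRange n g
sumRange-+ zero    f g = refl
sumRange-+ (suc n) f g rewrite sumRange-+ n f g = interchange (sumRange n f) (sumRange n g) (f n) (g n)
  where
  interchange : ∀ a b c d → a + b + (c + d) ≡ a + c + (b + d)
  interchange = solve-∀

sumRange-* : ∀ n c (f : ℕ → ℕ) → sumRange n (λ i → c * f i) ≡ c * sumRange n f
sumRange-* zero    c f = sym (*-zeroʳ c)
sumRange-* (suc n) c f rewrite sumRange-* n c f = sym (*-distribˡ-+ c (sumRange n f) (f n))

sumRange-head : ∀ n (f : ℕ → ℕ) → sumRange (suc n) f ≡ f 0 + sumRange n (λ i → f (suc i))
sumRange-head zero    f = +-comm 0 (f 0)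
sumRange-head (suc n) f rewrite sumRange-head n f = +-assoc (f 0) _ _

sumRange-reverse : ∀ n (f : ℕ → ℕ) → sumRange n f ≡ sumRange n (λ i → f (n ∸ suc i))
sumRange-reverse zero    f = refl
sumRange-reverse (suc n) f = begin
  sumRange n f + f n                        ≡⟨ cong (_+ f n) (sumRange-reverse n f) ⟩
  sumRange n (λ i → f (n ∸ suc i)) + f n    ≡⟨ +-comm _ (f n) ⟩
  f n + sumRange n (λ i → f (n ∸ suc i))    ≡⟨ sumRange-head n (λ i → f (n ∸ i)) ⟨
  sumRange (suc n) (λ i → f (n ∸ i))        ∎

sumRange-2* : ∀ n (f : ℕ → ℕ) →
  sumRange (2 * n) f ≡ sumRange n (λ i → f (2 * i)) + sumRange n (λ i → f (suc (2 * i)))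
sumRange-2* zero    f = refl
sumRange-2* (suc n) f = begin
  sumRange (2 * suc n) f
    ≡⟨ cong (λ m → sumRange m f) (*-suc 2 n) ⟩
  sumRange (2 * n) f + f (2 * n) + f (suc (2 * n))
    ≡⟨ cong (λ s → s + f (2 * n) + f (suc (2 * n))) (sumRange-2* n f) ⟩
  E + O + f (2 * n) + f (suc (2 * n))
    ≡⟨ interchange E O (f (2 * n)) (f (suc (2 * n))) ⟩
  E + f (2 * n) + (O + f (suc (2 * n)))
    ∎
  where
  E = sumRange n (λ i → f (2 * i))
  O = sumRange n (λ i → f (suc (2 * i)))
  interchange : ∀ a b c d → a + b + c + d ≡ a + c + (b + d)
  interchange = solve-∀

sumRange-odd-weights-split : ∀ n (f : ℕ → ℕ) →
  sumRange n (λ i → suc (2 * i) * f i) ≡ sumRange n f + 2 * sumRange n (λ i → i * f i)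
sumRange-odd-weights-split n f = begin
  sumRange n (λ i → suc (2 * i) * f i)              ≡⟨ sumRange-cong n (λ i _ → split i (f i)) ⟩
  sumRange n (λ i → f i + 2 * (i * f i))            ≡⟨ sumRange-+ n f _ ⟩
  sumRange n f + sumRange n (λ i → 2 * (i * f i))   ≡⟨ cong (sumRange n f +_) (sumRange-* n 2 _) ⟩
  sumRange n f + 2 * sumRange n (λ i → i * f i)     ∎
  where
  split : ∀ i x → suc (2 * i) * x ≡ x + 2 * (i * x)
  split = solve-∀

-- Pairing i with n - 1 - i: the odd weights 2i + 1 average to n.
sumRange-odd-weights : ∀ n (f : ℕ → ℕ) → (∀ i → i < n → f (n ∸ suc i) ≡ f i) →
  sumRange n (λ i → suc (2 * i) * f i) ≡ n * sumRange n f
sumRange-odd-weights n f f-sym = begin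
  sumRange n (λ i → suc (2 * i) * f i)     ≡⟨ sumRange-odd-weights-split n f ⟩
  S + 2 * T                                ≡⟨ double S T ⟩
  S + (T + T)                              ≡⟨ cong (λ t → S + (T + t)) T≡T′ ⟩
  S + (T + T′)                             ≡⟨ cong (S +_) (sumRange-+ n _ _) ⟨
  S + sumRange n (λ i → i * f i + (n ∸ suc i) * f i)
    ≡⟨ sumRange-+ n f _ ⟨
  sumRange n (λ i → f i + (i * f i + (n ∸ suc i) * f i))
    ≡⟨ sumRange-cong n (λ i i<n → weights-sum i<n (f i)) ⟩
  sumRange n (λ i → n * f i)               ≡⟨ sumRange-* n n f ⟩
  n * S                                    ∎
  where
  S = sumRange n f
  T = sumRange n (λ i → i * f i)
  T′ = sumRange n (λ i → (n ∸ suc i) * f i)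
  T≡T′ : T ≡ T′
  T≡T′ = trans (sumRange-reverse n (λ i → i * f i))
               (sumRange-cong n (λ i i<n → cong ((n ∸ suc i) *_) (f-sym i i<n)))
  double : ∀ s t → s + 2 * t ≡ s + (t + t)
  double = solve-∀
  weights-sum : ∀ {i} → i < n → ∀ x → x + (i * x + (n ∸ suc i) * x) ≡ n * x
  weights-sum {i} i<n x = trans (regroup i (n ∸ suc i) x) (cong (_* x) (m+[n∸m]≡n i<n))
    where
    regroup : ∀ i d x → x + (i * x + d * x) ≡ (suc i + d) * x
    regroup = solve-∀

convolution : (ℕ → ℕ) → (ℕ → ℕ) → ℕ → ℕ
convolution f g n = sumRange (suc n) (λ i → f i * g (n ∸ i))

-- The convolution at n - 1; it is the empty sum at n = 0.
convolution⁻ : (ℕ → ℕ) → (ℕ → ℕ) → ℕ → ℕ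
convolution⁻ f g n = sumRange n (λ i → f i * g (n ∸ suc i))

convolution-term-reflect : ∀ (f g : ℕ → ℕ) {n i} → i ≤ n →
  f (n ∸ i) * g (n ∸ (n ∸ i)) ≡ g i * f (n ∸ i)
convolution-term-reflect f g {n} {i} i≤n =
  trans (*-comm (f (n ∸ i)) _) (cong (λ j → g j * f (n ∸ i)) (m∸[m∸n]≡n i≤n))

convolution-comm : ∀ f g n → convolution f g n ≡ convolution g f n
convolution-comm f g n = trans (sumRange-reverse (suc n) _)
  (sumRange-cong (suc n) (λ i i≤n → convolution-term-reflect f g (≤-pred i≤n)))

C-sym : ∀ {m k n} → m + k ≡ n → n C m ≡ n C k
C-sym {m} {k} refl = trans (nCk≡nC[n∸k] (m≤m+n m k)) (cong ((m + k) C_) (m+n∸m≡n m k))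

[k+1]*[n+1]C[k+1]≡[n+1]*nCk : ∀ n k → suc k * (suc n C suc k) ≡ suc n * (n C k)
[k+1]*[n+1]C[k+1]≡[n+1]*nCk zero    zero    = refl
[k+1]*[n+1]C[k+1]≡[n+1]*nCk zero    (suc k) = *-zeroʳ (2 + k)
[k+1]*[n+1]C[k+1]≡[n+1]*nCk (suc n) zero    =
  trans (+-identityʳ _) (trans (nC1≡n (2 + n)) (sym (*-identityʳ (2 + n))))
[k+1]*[n+1]C[k+1]≡[n+1]*nCk (suc n) (suc k) = begin
  (2 + k) * (suc (suc n) C (2 + k))
    ≡⟨ cong ((2 + k) *_) (nCk+nC[k+1]≡[n+1]C[k+1] (suc n) (suc k)) ⟨
  (2 + k) * (x + y)
    ≡⟨ regroup k x y ⟩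
  suc k * x + (2 + k) * y + x
    ≡⟨ cong₂ (λ u v → u + v + x) ([k+1]*[n+1]C[k+1]≡[n+1]*nCk n k) ([k+1]*[n+1]C[k+1]≡[n+1]*nCk n (suc k)) ⟩
  suc n * (n C k) + suc n * (n C suc k) + x
    ≡⟨ cong (_+ x) (*-distribˡ-+ (suc n) (n C k) (n C suc k)) ⟨
  suc n * (n C k + n C suc k) + x
    ≡⟨ cong (λ z → suc n * z + x) (nCk+nC[k+1]≡[n+1]C[k+1] n k) ⟩
  suc n * x + x
    ≡⟨ +-comm (suc n * x) x ⟩
  (2 + n) * x
    ∎
  where
  x = suc n C suc k
  y = suc n C (2 + k)
  regroup : ∀ k x y → (2 + k) * (x + y) ≡ suc k * x + (2 + k) * y + x
  regroup = solve-∀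

central : ℕ → ℕ
central k = (2 * k) C k

nearCentral : ℕ → ℕ
nearCentral k = (2 * suc k) C k

central-rec : ∀ k → suc k * central (suc k) ≡ 2 * (suc (2 * k) * central k)
central-rec k = begin
  suc k * ((2 * suc k) C suc k)
    ≡⟨ cong (λ m → suc k * (m C suc k)) (*-suc 2 k) ⟩
  suc k * ((2 + 2 * k) C suc k)
    ≡⟨ [k+1]*[n+1]C[k+1]≡[n+1]*nCk (suc (2 * k)) k ⟩
  (2 + 2 * k) * (suc (2 * k) C k)
    ≡⟨ cong ((2 + 2 * k) *_) (C-sym {k} {suc k} (k+[1+k] k)) ⟩
  (2 + 2 * k) * (suc (2 * k) C suc k)
    ≡⟨ double k (suc (2 * k) C suc k) ⟩
  2 * (suc k * (suc (2 * k) C suc k))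
    ≡⟨ cong (2 *_) ([k+1]*[n+1]C[k+1]≡[n+1]*nCk (2 * k) k) ⟩
  2 * (suc (2 * k) * central k)
    ∎
  where
  k+[1+k] : ∀ k → k + suc k ≡ suc (2 * k)
  k+[1+k] = solve-∀
  double : ∀ k x → (2 + 2 * k) * x ≡ 2 * (suc k * x)
  double = solve-∀

central-suc-suc : ∀ k → central (suc (suc k)) ≡ 2 * central (suc k) + 2 * nearCentral k
central-suc-suc k = begin
  (2 * suc (suc k)) C suc (suc k)
    ≡⟨ cong (_C suc (suc k)) (*-suc 2 (suc k)) ⟩
  suc (suc N) C suc (suc k)
    ≡⟨ nCk+nC[k+1]≡[n+1]C[k+1] (suc N) (suc k) ⟨
  suc N C suc k + suc N C suc (suc k)
    ≡⟨ cong₂ _+_ (nCk+nC[k+1]≡[n+1]C[k+1] N k) (nCk+nC[k+1]≡[n+1]C[k+1] N (suc k)) ⟨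
  N C k + N C suc k + (N C suc k + N C suc (suc k))
    ≡⟨ cong (λ z → N C k + N C suc k + (N C suc k + z)) (C-sym {k} {suc (suc k)} (k+[2+k] k)) ⟨
  N C k + N C suc k + (N C suc k + N C k)
    ≡⟨ regroup (N C k) (N C suc k) ⟩
  2 * central (suc k) + 2 * nearCentral k
    ∎
  where
  N = 2 * suc k
  k+[2+k] : ∀ k → k + suc (suc k) ≡ 2 * suc k
  k+[2+k] = solve-∀
  regroup : ∀ x y → x + y + (y + x) ≡ 2 * y + 2 * x
  regroup = solve-∀

convolution-central-suc : ∀ m →
  convolution central central (suc m) ≡ 4 * convolution central central m
convolution-central-suc m = *-cancelˡ-≡ S′ (4 * S) (suc m) (+-cancelˡ-≡ S′ _ _ (begin
  S′ + suc m * S′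
    ≡⟨ sumRange-odd-weights (suc (suc m)) W (reflect (suc m)) ⟨
  sumRange (2 + m) (λ i → suc (2 * i) * W i)
    ≡⟨ sumRange-odd-weights-split (2 + m) W ⟩
  S′ + 2 * sumRange (2 + m) (λ i → i * W i)
    ≡⟨ cong (λ t → S′ + 2 * t) (sumRange-head (suc m) _) ⟩
  S′ + 2 * sumRange (suc m) (λ i → suc i * W (suc i))
    ≡⟨ cong (λ t → S′ + 2 * t) (sumRange-cong (suc m) (λ i _ → rec-term i)) ⟩
  S′ + 2 * sumRange (suc m) (λ i → 2 * (suc (2 * i) * w i))
    ≡⟨ cong (λ t → S′ + 2 * t) (sumRange-* (suc m) 2 _) ⟩
  S′ + 2 * (2 * sumRange (suc m) (λ i → suc (2 * i) * w i))
    ≡⟨ cong (λ t → S′ + 2 * (2 * t)) (sumRange-odd-weights (suc m) w (reflect m)) ⟩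
  S′ + 2 * (2 * (suc m * S))
    ≡⟨ cong (S′ +_) (quadruple m S) ⟩
  S′ + suc m * (4 * S)
    ∎))
  where
  S = convolution central central m
  S′ = convolution central central (suc m)
  w W : ℕ → ℕ
  w i = central i * central (m ∸ i)
  W i = central i * central (suc m ∸ i)
  reflect : ∀ n i → i < suc n →
    central (n ∸ i) * central (n ∸ (n ∸ i)) ≡ central i * central (n ∸ i)
  reflect n i i≤n = convolution-term-reflect central central (≤-pred i≤n)
  rec-term : ∀ i → suc i * W (suc i) ≡ 2 * (suc (2 * i) * w i)
  rec-term i = begin
    suc i * (central (suc i) * c)         ≡⟨ *-assoc (suc i) (central (suc i)) c ⟨
    suc i * central (suc i) * c           ≡⟨ cong (_* c) (central-rec i) ⟩
    2 * (suc (2 * i) * central i) * c     ≡⟨ reassoc (suc (2 * i)) (central i) c ⟩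
    2 * (suc (2 * i) * (central i * c))   ∎
    where
    c = central (m ∸ i)
    reassoc : ∀ a x y → 2 * (a * x) * y ≡ 2 * (a * (x * y))
    reassoc = solve-∀
  quadruple : ∀ m s → 2 * (2 * (suc m * s)) ≡ suc m * (4 * s)
  quadruple = solve-∀

convolution-central : ∀ m → convolution central central m ≡ 4 ^ m
convolution-central zero    = refl
convolution-central (suc m) =
  trans (convolution-central-suc m) (cong (4 *_) (convolution-central m))

∸-from-+ : ∀ {m k n} → m + k ≡ n → n ∸ m ≡ k
∸-from-+ {m} {k} refl = m+n∸m≡n m k

1+2n∸2i≡1+2[n∸i] : ∀ {n i} → i ≤ n → suc (2 * n) ∸ 2 * i ≡ suc (2 * (n ∸ i))
1+2n∸2i≡1+2[n∸i] {n} {i} i≤n =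
  ∸-from-+ {2 * i} (trans (regroup i (n ∸ i)) (cong (λ k → suc (2 * k)) (m+[n∸m]≡n i≤n)))
  where
  regroup : ∀ i p → 2 * i + suc (2 * p) ≡ suc (2 * (i + p))
  regroup = solve-∀

2n∸[1+2i]≡1+2[n∸[1+i]] : ∀ {n i} → i < n → 2 * n ∸ suc (2 * i) ≡ suc (2 * (n ∸ suc i))
2n∸[1+2i]≡1+2[n∸[1+i]] {n} {i} i<n =
  ∸-from-+ {suc (2 * i)} (trans (regroup i (n ∸ suc i)) (cong (2 *_) (m+[n∸m]≡n i<n)))
  where
  regroup : ∀ i p → suc (2 * i) + suc (2 * p) ≡ 2 * (suc i + p)
  regroup = solve-∀

centralEven centralOdd nearCentralOdd : ℕ → ℕ
centralEven k = central (2 * k)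
centralOdd k = central (suc (2 * k))
nearCentralOdd k = nearCentral (suc (2 * k))

convolution-central-odd : ∀ n →
  convolution central central (suc (2 * n)) ≡ 2 * convolution centralOdd centralEven n
convolution-central-odd n = begin
  sumRange (2 + 2 * n) F                   ≡⟨ cong (λ m → sumRange m F) (*-suc 2 n) ⟨
  sumRange (2 * suc n) F                   ≡⟨ sumRange-2* (suc n) F ⟩
  sumRange (suc n) (λ i → F (2 * i)) + sumRange (suc n) (λ i → F (suc (2 * i)))
    ≡⟨ cong₂ _+_ (sumRange-cong (suc n) even-term) (sumRange-cong (suc n) odd-term) ⟩
  convolution centralEven centralOdd n + O ≡⟨ cong (_+ O) (convolution-comm centralEven centralOdd n) ⟩
  O + O                                    ≡⟨ cong (O +_) (+-identityʳ O) ⟨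
  2 * O                                    ∎
  where
  F : ℕ → ℕ
  F i = central i * central (suc (2 * n) ∸ i)
  O = convolution centralOdd centralEven n
  even-term : ∀ i → i < suc n → F (2 * i) ≡ centralEven i * centralOdd (n ∸ i)
  even-term i i≤n = cong (λ k → centralEven i * central k) (1+2n∸2i≡1+2[n∸i] (≤-pred i≤n))
  odd-term : ∀ i → i < suc n → F (suc (2 * i)) ≡ centralOdd i * centralEven (n ∸ i)
  odd-term i _ = cong (λ k → centralOdd i * central k) (sym (*-distribˡ-∸ 2 n i))

convolution-central-even : ∀ n → convolution central central (2 * n)
  ≡ convolution centralEven centralEven n + convolution⁻ centralOdd centralOdd n
convolution-central-even n = begin
  sumRange (2 * n) G + G (2 * n)                       ≡⟨ cong (_+ G (2 * n)) (sumRange-2* n G) ⟩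
  E + O + G (2 * n)                                    ≡⟨ swap E O (G (2 * n)) ⟩
  sumRange (suc n) (λ i → G (2 * i)) + O
    ≡⟨ cong₂ _+_ (sumRange-cong (suc n) even-term) (sumRange-cong n odd-term) ⟩
  convolution centralEven centralEven n + convolution⁻ centralOdd centralOdd n
    ∎
  where
  G : ℕ → ℕ
  G i = central i * central (2 * n ∸ i)
  E = sumRange n (λ i → G (2 * i))
  O = sumRange n (λ i → G (suc (2 * i)))
  swap : ∀ a b c → a + b + c ≡ a + c + b
  swap = solve-∀
  even-term : ∀ i → i < suc n → G (2 * i) ≡ centralEven i * centralEven (n ∸ i)
  even-term i _ = cong (λ k → centralEven i * central k) (sym (*-distribˡ-∸ 2 n i))
  odd-term : ∀ i → i < n → G (suc (2 * i)) ≡ centralOdd i * centralOdd (n ∸ suc i)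
  odd-term i i<n = cong (λ k → centralOdd i * central k) (2n∸[1+2i]≡1+2[n∸[1+i]] i<n)

centralOdd-suc : ∀ k → centralOdd (suc k) ≡ 2 * centralEven (suc k) + 2 * nearCentralOdd k
centralOdd-suc k = begin
  central (suc (2 * suc k))                            ≡⟨ cong (λ m → central (suc m)) (*-suc 2 k) ⟩
  central (3 + 2 * k)                                  ≡⟨ central-suc-suc (suc (2 * k)) ⟩
  2 * central (2 + 2 * k) + 2 * nearCentralOdd k
    ≡⟨ cong (λ m → 2 * central m + 2 * nearCentralOdd k) (*-suc 2 k) ⟨
  2 * centralEven (suc k) + 2 * nearCentralOdd k       ∎

convolution-odd-even≡2*[even-even+near-even] : ∀ n → convolution centralOdd centralEven n
  ≡ 2 * convolution centralEven centralEven n + 2 * convolution⁻ nearCentralOdd centralEven n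
convolution-odd-even≡2*[even-even+near-even] n = begin
  convolution centralOdd centralEven n               ≡⟨ sumRange-head n _ ⟩
  2 * centralEven n + sumRange n (λ i → centralOdd (suc i) * e i)
    ≡⟨ cong (2 * centralEven n +_) (trans (sumRange-cong n (λ i _ → split i)) (sumRange-+ n _ _)) ⟩
  2 * centralEven n + (sumRange n (λ i → 2 * (centralEven (suc i) * e i))
                       + sumRange n (λ i → 2 * (nearCentralOdd i * e i)))
    ≡⟨ cong (2 * centralEven n +_) (cong₂ _+_ (sumRange-* n 2 _) (sumRange-* n 2 _)) ⟩
  2 * centralEven n + (2 * X + 2 * Y)                ≡⟨ regroup (centralEven n) X Y ⟩
  2 * (1 * centralEven n + X) + 2 * Y
    ≡⟨ cong (λ t → 2 * t + 2 * Y) (sumRange-head n _) ⟨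
  2 * convolution centralEven centralEven n + 2 * Y  ∎
  where
  e : ℕ → ℕ
  e i = centralEven (n ∸ suc i)
  X = sumRange n (λ i → centralEven (suc i) * e i)
  Y = convolution⁻ nearCentralOdd centralEven n
  split : ∀ i →
    centralOdd (suc i) * e i ≡ 2 * (centralEven (suc i) * e i) + 2 * (nearCentralOdd i * e i)
  split i = trans (cong (_* e i) (centralOdd-suc i))
                  (distrib (centralEven (suc i)) (nearCentralOdd i) (e i))
    where
    distrib : ∀ a b c → (2 * a + 2 * b) * c ≡ 2 * (a * c) + 2 * (b * c)
    distrib = solve-∀
  regroup : ∀ a x y → 2 * a + (2 * x + 2 * y) ≡ 2 * (1 * a + x) + 2 * y
  regroup = solve-∀

convolution-odd-even≡2*[even-even+odd-odd] : ∀ n → convolution centralOdd centralEven n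
  ≡ 2 * (convolution centralEven centralEven n + convolution⁻ centralOdd centralOdd n)
convolution-odd-even≡2*[even-even+odd-odd] n = *-cancelˡ-≡ _ _ 2 (begin
  2 * convolution centralOdd centralEven n    ≡⟨ convolution-central-odd n ⟨
  convolution central central (suc (2 * n))   ≡⟨ convolution-central (suc (2 * n)) ⟩
  4 * 4 ^ (2 * n)                             ≡⟨ cong (4 *_) (convolution-central (2 * n)) ⟨
  4 * convolution central central (2 * n)     ≡⟨ cong (4 *_) (convolution-central-even n) ⟩
  4 * (E + R)                                 ≡⟨ *-assoc 2 2 (E + R) ⟩
  2 * (2 * (E + R))                           ∎)
  where
  E = convolution centralEven centralEven n
  R = convolution⁻ centralOdd centralOdd n

convolution⁻-near-even≡odd-odd : ∀ n →
  convolution⁻ nearCentralOdd centralEven n ≡ convolution⁻ centralOdd centralOdd n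
convolution⁻-near-even≡odd-odd n = *-cancelˡ-≡ L R 2 (+-cancelˡ-≡ (2 * E) _ _ (begin
  2 * E + 2 * L                               ≡⟨ convolution-odd-even≡2*[even-even+near-even] n ⟨
  convolution centralOdd centralEven n        ≡⟨ convolution-odd-even≡2*[even-even+odd-odd] n ⟩
  2 * (E + R)                                 ≡⟨ *-distribˡ-+ 2 E R ⟩
  2 * E + 2 * R                               ∎))
  where
  E = convolution centralEven centralEven n
  L = convolution⁻ nearCentralOdd centralEven n
  R = convolution⁻ centralOdd centralOdd n

∸∸-from-+ : ∀ {m n o k} → n + o + k ≡ m → m ∸ n ∸ o ≡ k
∸∸-from-+ {m} {n} {o} eq = trans (∸-+-assoc m n o) (∸-from-+ eq)

lhs-summand : ∀ {n} j p → suc j + p ≡ n →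
  ((4 * suc j) C (2 * suc j ∸ 1)) * ((4 * n ∸ 4 * suc j) C (2 * n ∸ 2 * suc j))
    ≡ nearCentralOdd j * centralEven p
lhs-summand j p refl = cong₂ _*_
  (cong₂ _C_ (4[1+j] j) (cong (_∸ 1) (*-suc 2 j)))
  (cong₂ _C_ (∸-from-+ {4 * suc j} (4*-split j p)) (∸-from-+ {2 * suc j} (2*-split j p)))
  where
  4[1+j] : ∀ j → 4 * suc j ≡ 2 * suc (suc (2 * j))
  4[1+j] = solve-∀
  4*-split : ∀ j p → 4 * suc j + 2 * (2 * p) ≡ 4 * (suc j + p)
  4*-split = solve-∀
  2*-split : ∀ j p → 2 * suc j + 2 * p ≡ 2 * (suc j + p)
  2*-split = solve-∀

rhs-summand : ∀ {n} i p → suc i + p ≡ n →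
  ((4 * i + 2) C (2 * i + 1)) * ((4 * n ∸ 4 * i ∸ 2) C (2 * n ∸ 2 * i ∸ 1))
    ≡ centralOdd i * centralOdd p
rhs-summand i p refl = cong₂ _*_
  (cong₂ _C_ (4i+2 i) (+-comm (2 * i) 1))
  (cong₂ _C_ (∸∸-from-+ {n = 4 * i} {2} (4*-split i p)) (∸∸-from-+ {n = 2 * i} {1} (2*-split i p)))
  where
  4i+2 : ∀ i → 4 * i + 2 ≡ 2 * suc (2 * i)
  4i+2 = solve-∀
  4*-split : ∀ i p → 4 * i + 2 + 2 * suc (2 * p) ≡ 4 * (suc i + p)
  4*-split = solve-∀
  2*-split : ∀ i p → 2 * i + 1 + suc (2 * p) ≡ 2 * (suc i + p)
  2*-split = solve-∀

corollary10 : (n : ℕ) →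
    sumRange n (λ j → ((4 * suc j) C (2 * suc j ∸ 1)) * ((4 * n ∸ 4 * suc j) C (2 * n ∸ 2 * suc j)))
      ≡ sumRange n (λ i → ((4 * i + 2) C (2 * i + 1)) * ((4 * n ∸ 4 * i ∸ 2) C (2 * n ∸ 2 * i ∸ 1)))
corollary10 n = begin
  _ ≡⟨ sumRange-cong n (λ j j<n → lhs-summand j (n ∸ suc j) (m+[n∸m]≡n j<n)) ⟩
  convolution⁻ nearCentralOdd centralEven n
    ≡⟨ convolution⁻-near-even≡odd-odd n ⟩
  convolution⁻ centralOdd centralOdd n
    ≡⟨ sumRange-cong n (λ i i<n → rhs-summand i (n ∸ suc i) (m+[n∸m]≡n i<n)) ⟨
  _ ∎
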